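{- Let $G=(V,E)$ be a finite graph and let $x^0\in\{ -1,1\}^V$ be any initial configuration. Define Majority Dynamics by $x^{t+1}_i=-1$ if $\sum_{j\sim i}x^t_j<0$, $x^{t+1}_i=x^t_i$ if $\sum_{j\sim i}x^t_j=0$, and $x^{t+1}_i=1$ if $\sum_{j\sim i}x^t_j>0$. Let $T$ be such that $x^{t+2}=x^t$ for all $t\ge T$, and call a vertex $i$ oscillating if $x^t_i\neq x^{t+1}_i$ for $t\ge T$. Let $H$ be the subgraph of $G$ induced by the oscillating vertices. Then every vertex of degree exactly $1$ in $H$ (a leaf of $H$) has odd degree in $G$.
   Context: It is known that Majority Dynamics on a finite graph eventually enters a cycle of length at most two, so a time $T$ with $x^{t+2}=x^t$ for all $t\ge T$ always exists; for $t\ge T$ each vertex either satisfies $x^t_i=x^{t+1}_i$ for all such $t$ or $x^t_i\ne x^{t+1}_i$ for all such $t$. -}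

module Defs where

open import Data.Nat using (ℕ; zero; suc; _+_; _≤_)
open import Data.Integer as ℤ using (ℤ; +_; -[1+_]; 0ℤ)
open import Data.Bool using (Bool; true; false; if_then_else_)
open import Data.Fin using (Fin)
open import Data.List using (List; foldr; map; length; filter)
open import Data.List.Base using (allFin)
open import Data.Product using (Σ; _×_; ∃)
open import Data.Sum using (_⊎_)
open import Relation.Binary.PropositionalEquality using (_≡_; _≢_)
open import Relation.Nullary.Decidable using (does)
open import Data.Bool.Properties using () renaming (T? to T?)
open import Data.Bool using (T)

record Graph (n : ℕ) : Set where
  field
    adj   : Fin n → Fin n → Bool
    sym   : ∀ i j → adj i j ≡ adj j i
    irrefl : ∀ i → adj i i ≡ false
open Graph public

-- Configurations in {-1,1}^V: true stands for +1, false for -1.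
Config : ℕ → Set
Config n = Fin n → Bool

spin : Bool → ℤ
spin true  = + 1
spin false = -[1+ 0 ]

nbrSum : ∀ {n} → Graph n → Config n → Fin n → ℤ
nbrSum {n} G x i =
  foldr ℤ._+_ 0ℤ (map (λ j → if adj G i j then spin (x j) else 0ℤ) (allFin n))

stepVal : ℤ → Bool → Bool
stepVal (+ zero)    b = b
stepVal (+ (suc _)) b = true
stepVal -[1+ _ ]    b = false

step : ∀ {n} → Graph n → Config n → Config n
step G x i = stepVal (nbrSum G x i) (x i)

MD : ∀ {n} → Graph n → Config n → ℕ → Config n
MD G x0 zero    = x0
MD G x0 (suc t) = step G (MD G x0 t)

deg : ∀ {n} → Graph n → Fin n → ℕ
deg {n} G i = length (filter (λ j → T? (adj G i j)) (allFin n))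

Oscillating : ∀ {n} → Graph n → Config n → ℕ → Fin n → Set
Oscillating G x0 T i = ∀ t → T ≤ t → MD G x0 t i ≢ MD G x0 (suc t) i

-- i is a leaf of H (subgraph induced by the oscillating vertices):
-- i ∈ H and i has exactly one neighbour in H.
IsLeafOfH : ∀ {n} → Graph n → Config n → ℕ → Fin n → Set
IsLeafOfH G x0 T i =
  Oscillating G x0 T i ×
  Σ _ (λ j → adj G i j ≡ true × Oscillating G x0 T j ×
        (∀ k → adj G i k ≡ true → Oscillating G x0 T k → k ≡ j))

{-# OPTIONS --safe #-}
-- Let j be the unique oscillating neighbour of the leaf i.  A neighbour of i
-- that changes between times T and T + 1 oscillates (by 2-periodicity), so
-- only j changes and the neighbour sum of i moves by exactly ±2.  As i flips
-- at both steps, both sums are nonzero with opposite signs, so the sum at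
-- time T is ±1.  A sum of deg(i) terms ±1 has the parity of deg(i).
module Submission where

open import Defs hiding (sym)
open import Data.Bool using (Bool; true; false; if_then_else_)
open import Data.Bool.Properties using (_≟_; T?)
open import Data.Fin as Fin using (Fin; punchIn)
open import Data.Fin.Properties using (punchInᵢ≢i)
open import Data.Integer as ℤ using (ℤ; +_; -[1+_]; 0ℤ; _-_; +<+; -<+)
import Data.Integer.Properties as ℤP
open import Data.Integer.Divisibility.Signed
  using (∣ᵤ⇒∣; ∣⇒∣ᵤ; ∣-refl; ∣m⇒∣m*n; ∣m+n∣n⇒∣m) renaming (_∣_ to _∣ℤ_)
open import Data.Integer.Tactic.RingSolver using (solve-∀)
open import Algebra.Properties.AbelianGroup ℤP.+-0-abelianGroup using (xyx⁻¹≈y)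
open import Algebra.Properties.CommutativeMonoid.Sum ℤP.+-0-commutativeMonoid
  using (sum; sum-remove; sum-cong-≗)
open import Data.List using (List; []; _∷_; foldr; map; length; filter; tabulate; allFin)
open import Data.List.Properties using (map-tabulate)
open import Data.Nat using (ℕ; zero; suc; _+_; 2+; _≤_; _≤′_; ≤′-refl; ≤′-step; z≤n; s≤s)
open import Data.Nat.Divisibility using (_∣_; ∣1⇒≡1)
open import Data.Nat.Properties using (≤′⇒≤; ≤⇒≤′; ≤-refl; n≤1+n)
open import Data.Product using (∃; _,_)
open import Data.Vec.Functional using (removeAt)
open import Function using (id; _∘_)
open import Relation.Binary.PropositionalEquality
open import Relation.Nullary using (¬_; yes; no; contradiction)

period2-alternates : ∀ {a} {A : Set a} (f : ℕ → A) {T} →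
  (∀ t → T ≤ t → f (2 + t) ≡ f t) →
  f T ≢ f (suc T) → ∀ t → T ≤ t → f t ≢ f (suc t)
period2-alternates f {T} periodic fT≢fT+1 t T≤t = go (≤⇒≤′ T≤t)
  where
  go : ∀ {t} → T ≤′ t → f t ≢ f (suc t)
  go ≤′-refl                         = fT≢fT+1
  go {suc t} (≤′-step T≤′t) ft+1≡ft+2 =
    go T≤′t (sym (trans ft+1≡ft+2 (periodic t (≤′⇒≤ T≤′t))))

foldr-tabulate≡sum : ∀ {n} (g : Fin n → ℤ) → foldr ℤ._+_ 0ℤ (tabulate g) ≡ sum g
foldr-tabulate≡sum {zero}  g = refl
foldr-tabulate≡sum {suc n} g = cong (ℤ._+_ (g Fin.zero)) (foldr-tabulate≡sum (g ∘ Fin.suc))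

sum-minus≡sum-removeAt : ∀ {n} (g : Fin (suc n) → ℤ) j → sum g - g j ≡ sum (removeAt g j)
sum-minus≡sum-removeAt g j = trans (cong (_- g j) (sum-remove {i = j} g)) (xyx⁻¹≈y (g j) _)

maskedSpin : ∀ {a} {A : Set a} → (A → Bool) → (A → Bool) → A → ℤ
maskedSpin p x k = if p k then spin (x k) else 0ℤ

spinSum : ∀ {a} {A : Set a} → (A → Bool) → (A → Bool) → List A → ℤ
spinSum p x L = foldr ℤ._+_ 0ℤ (map (maskedSpin p x) L)

spinSum-parity : ∀ {a} {A : Set a} (p x : A → Bool) (L : List A) →
  ∃ λ m → + length (filter (T? ∘ p) L) ≡ spinSum p x L ℤ.+ + 2 ℤ.* m
spinSum-parity p x [] = 0ℤ , refl
spinSum-parity p x (k ∷ L) with p k | x k | spinSum-parity p x L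
... | false | _     | m , eq = m , trans eq (cong (ℤ._+ _) (sym (ℤP.+-identityˡ (spinSum p x L))))
... | true  | true  | m , eq = m , trans (cong (ℤ._+_ (+ 1)) eq) (sym (ℤP.+-assoc (+ 1) (spinSum p x L) _))
... | true  | false | m , eq = m ℤ.+ + 1 , trans (cong (ℤ._+_ (+ 1)) eq) (shift (spinSum p x L) m)
  where
  shift : ∀ s m → + 1 ℤ.+ (s ℤ.+ + 2 ℤ.* m) ≡ (ℤ.- + 1 ℤ.+ s) ℤ.+ + 2 ℤ.* (m ℤ.+ + 1)
  shift = solve-∀

spin-odd : ∀ b → ¬ (+ 2 ∣ℤ spin b)
spin-odd true  2∣1  with ∣1⇒≡1 (∣⇒∣ᵤ 2∣1)
... | ()
spin-odd false 2∣-1 with ∣1⇒≡1 (∣⇒∣ᵤ 2∣-1)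
... | ()

spinSum-unit⇒odd-length : ∀ {a} {A : Set a} (p x : A → Bool) (L : List A) b →
  spinSum p x L ≡ spin b → ¬ (2 ∣ length (filter (T? ∘ p) L))
spinSum-unit⇒odd-length p x L b sum≡spin 2∣length with spinSum-parity p x L
... | m , length≡ = spin-odd b (∣m+n∣n⇒∣m 2∣spin+2m (∣m⇒∣m*n m ∣-refl))
  where
  2∣spin+2m : + 2 ∣ℤ spin b ℤ.+ + 2 ℤ.* m
  2∣spin+2m = subst (+ 2 ∣ℤ_) (trans length≡ (cong (ℤ._+ _) sum≡spin))
                    (∣ᵤ⇒∣ {+ 2} {+ length (filter (T? ∘ p) L)} 2∣length)

spinSum-allFin≡sum : ∀ {n} (p x : Fin n → Bool) → spinSum p x (allFin n) ≡ sum (maskedSpin p x)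
spinSum-allFin≡sum p x = trans (cong (foldr ℤ._+_ 0ℤ) (map-tabulate id (maskedSpin p x)))
                               (foldr-tabulate≡sum (maskedSpin p x))

spinSum-minus-cong : ∀ {n} (p : Fin n → Bool) {x y : Fin n → Bool} {j} → p j ≡ true →
  (∀ k → k ≢ j → p k ≡ true → x k ≡ y k) →
  spinSum p x (allFin n) - spin (x j) ≡ spinSum p y (allFin n) - spin (y j)
spinSum-minus-cong {suc _} p {x} {y} {j} pj agree = begin
  spinSum p x (allFin _) - spin (x j)  ≡⟨ minus≡sum-removeAt x ⟩
  sum (removeAt (maskedSpin p x) j)    ≡⟨ sum-cong-≗ (λ k → agree′ (punchIn j k) (punchInᵢ≢i j k)) ⟩
  sum (removeAt (maskedSpin p y) j)    ≡⟨ minus≡sum-removeAt y ⟨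
  spinSum p y (allFin _) - spin (y j)  ∎
  where
  open ≡-Reasoning
  minus≡sum-removeAt : ∀ z → spinSum p z (allFin _) - spin (z j) ≡ sum (removeAt (maskedSpin p z) j)
  minus≡sum-removeAt z = begin
    spinSum p z (allFin _) - spin (z j)
      ≡⟨ cong₂ _-_ (spinSum-allFin≡sum p z) (cong (λ b → if b then spin (z j) else 0ℤ) (sym pj)) ⟩
    sum (maskedSpin p z) - maskedSpin p z j  ≡⟨ sum-minus≡sum-removeAt (maskedSpin p z) j ⟩
    sum (removeAt (maskedSpin p z) j)        ∎
  agree′ : ∀ k → k ≢ j → maskedSpin p x k ≡ maskedSpin p y k
  agree′ k k≢j with p k in pk
  ... | false = refl
  ... | true  = cong spin (agree k k≢j pk)

Favours : Bool → ℤ → Set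
Favours true  s = 0ℤ ℤ.< s
Favours false s = s ℤ.< 0ℤ

flip⇒favours : ∀ s b → stepVal s b ≢ b → Favours (stepVal s b) s
flip⇒favours (+ zero)  b     flip = contradiction refl flip
flip⇒favours (+ suc _) true  flip = contradiction refl flip
flip⇒favours (+ suc _) false _    = +<+ (s≤s z≤n)
flip⇒favours -[1+ _ ]  true  _    = -<+
flip⇒favours -[1+ _ ]  false flip = contradiction refl flip

-- s and s' have opposite signs but differ by exactly 2, so s = ±1.
favours-opposite⇒unit : ∀ {a a' s s' b c} → Favours a s → Favours a' s' → a ≢ a' → b ≢ c →
  s - spin b ≡ s' - spin c → s ≡ spin a
favours-opposite⇒unit {true}  {true}  _ _ a≢a' _ _ = contradiction refl a≢a'
favours-opposite⇒unit {false} {false} _ _ a≢a' _ _ = contradiction refl a≢a'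
favours-opposite⇒unit {b = true}  {c = true}  _ _ _ b≢c _ = contradiction refl b≢c
favours-opposite⇒unit {b = false} {c = false} _ _ _ b≢c _ = contradiction refl b≢c
favours-opposite⇒unit {true}  {false} (+<+ {n = 1} _) _ _ _ _ = refl
favours-opposite⇒unit {false} {true}  (-<+ {m = 0}) _ _ _ _ = refl
favours-opposite⇒unit {true}  {false} {b = true}  {false} (+<+ {n = 2+ _} _) (-<+ {m = 0})     _ _ ()
favours-opposite⇒unit {true}  {false} {b = true}  {false} (+<+ {n = 2+ _} _) (-<+ {m = suc _}) _ _ ()
favours-opposite⇒unit {true}  {false} {b = false} {true}  (+<+ {n = 2+ _} _) -<+               _ _ ()
favours-opposite⇒unit {false} {true}  {b = false} {true}  (-<+ {m = suc _}) (+<+ {n = 1} _)    _ _ ()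
favours-opposite⇒unit {false} {true}  {b = false} {true}  (-<+ {m = suc _}) (+<+ {n = 2+ _} _) _ _ ()
favours-opposite⇒unit {false} {true}  {b = true}  {false} (-<+ {m = suc _}) (+<+ _)            _ _ ()

mainTheorem2 : (n : ℕ) (G : Graph n) (x0 : Config n) (T : ℕ) →
    (∀ t → T ≤ t → ∀ i → MD G x0 (2 + t) i ≡ MD G x0 t i) →
    ∀ i → IsLeafOfH G x0 T i → ¬ (2 ∣ deg G i)
mainTheorem2 n G x0 T periodic i (i-osc , j , i~j , j-osc , j-unique) =
  spinSum-unit⇒odd-length (adj G i) (x T) (allFin n) (x (suc T) i) sum≡spin
  where
  x : ℕ → Config n
  x = MD G x0
  others-stay : ∀ k → k ≢ j → adj G i k ≡ true → x T k ≡ x (suc T) k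
  others-stay k k≢j i~k with x T k ≟ x (suc T) k
  ... | yes stays  = stays
  ... | no changes = contradiction (j-unique k i~k k-osc) k≢j
    where
    k-osc : Oscillating G x0 T k
    k-osc = period2-alternates (λ t → x t k) (λ t T≤t → periodic t T≤t k) changes
  sum≡spin : nbrSum G (x T) i ≡ spin (x (suc T) i)
  sum≡spin = favours-opposite⇒unit
    (flip⇒favours (nbrSum G (x T) i) (x T i) (≢-sym (i-osc T ≤-refl)))
    (flip⇒favours (nbrSum G (x (suc T)) i) (x (suc T) i) (≢-sym (i-osc (suc T) (n≤1+n T))))
    (i-osc (suc T) (n≤1+n T))
    (j-osc T ≤-refl)
    (spinSum-minus-cong (adj G i) i~j others-stay)
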